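{- Let $n\ge3$, $1\le k<n$, let $u=(i,x)$ and $v=(j,y)$ be vertices of $\mathrm{PX}(n,k)$, and let $M=\{i,i+1,\dots,i+k-1\}\cap\{j,j+1,\dots,j+k-1\}\subseteq\mathbb Z_n$. Then there exists $\alpha\in\mathcal A$ with $\alpha\cdot u=v$ and $\alpha\cdot v=u$ if and only if one of the following holds: (1) $j=i$; (2) $j\neq i$ and for all $m\in M$, $(x^-)_{m-j}=y_{m-j}$ if and only if $(y^-)_{m-i}=x_{m-i}$; (3) $n$ is even, $j=i+n/2$, and for all $m\in M$, $x_{m-j}=y_{m-j}$ if and only if $y_{m-i}=x_{m-i}$.
   Context: For integers $n\ge 3$ and $1\le k<n$, $\mathrm{PX}(n,k)$ has vertex set $\mathbb Z_n\times\mathbb Z_2^k$, vertices written $(i,x)$ with $x=x_0x_1\cdots x_{k-1}$ (bit indices read in $\mathbb Z_k$; for $m$ in the window $\{j,\dots,j+k-1\}$, $m-j$ is the corresponding element of $\{0,\dots,k-1\}$); $(i,x)$ and $(j,y)$ are adjacent iff (up to swapping) $j=i+1$ in $\mathbb Z_n$, $x=az_1\cdots z_{k-1}$ and $y=z_1\cdots z_{k-1}b$ for some bits $a,b,z_t$. For a bitstring $x$, $x^-=x_{k-1}\cdots x_0$, so $(x^-)_t=x_{k-1-t}$, and $x^t$ is $x$ with bit $x_t$ flipped. Automorphisms: $\rho\cdot(i,x)=(i+1,x)$; $\mu\cdot(i,x)=(-i,x^-)$; for $s\in\mathbb Z_n$, $\tau_s\cdot(i,x)=(i,x^{s-i})$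 if $i\in\{s,s-1,\dots,s-k+1\}$ and $(i,x)$ otherwise. Let $K=\langle\tau_0,\dots,\tau_{n-1}\rangle\cong\mathbb Z_2^n$ and let $\mathcal A=K\rtimes\langle\rho,\mu\rangle$ be the subgroup of $\operatorname{Aut}(\mathrm{PX}(n,k))$ generated by $\rho,\mu,\tau_0,\dots,\tau_{n-1}$. -}

module Defs where

open import Data.Nat using (ℕ; zero; suc; _+_; _∸_; _<_; _<?_)
open import Data.Nat.DivMod using (_%_; m%n<n)
open import Data.Fin using (Fin; toℕ; fromℕ<)
open import Data.Vec using (Vec; reverse; updateAt; lookup)
open import Data.Bool using (Bool; not)
open import Data.Product using (_×_; _,_)
open import Data.List using (List; []; _∷_)
open import Relation.Nullary using (yes; no)

-- Vertices of PX(n,k): Z_n × Z_2^k, with Z_n = Fin n and bitstrings Vec Bool k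
Vertex : ℕ → ℕ → Set
Vertex n k = Fin n × Vec Bool k

-- reduce a natural number mod n into Z_n (a Fin n witnesses n ≠ 0)
toFinMod : ∀ {n} → Fin n → ℕ → Fin n
toFinMod {suc n} _ a = fromℕ< (m%n<n a (suc n))

addMod : ∀ {n} → Fin n → ℕ → Fin n
addMod i a = toFinMod i (toℕ i + a)

negMod : ∀ {n} → Fin n → Fin n
negMod {n} i = toFinMod i (n ∸ toℕ i)

diffℕ : ∀ {n} → Fin n → Fin n → ℕ
diffℕ {suc n} m j = (toℕ m + (suc n ∸ toℕ j)) % suc n

flip : ∀ {k} → Vec Bool k → Fin k → Vec Bool k
flip x t = updateAt x t not

-- generators of 𝒜 (ρ⁻¹ included so that words generate the subgroup)
data Gen (n : ℕ) : Set where
  ρ ρ⁻¹ μ : Gen n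
  τ : Fin n → Gen n

actGen : ∀ {n k} → Gen n → Vertex n k → Vertex n k
actGen {n} ρ (i , x) = addMod i 1 , x
actGen {n} ρ⁻¹ (i , x) = addMod i (n ∸ 1) , x
actGen μ (i , x) = negMod i , reverse x
actGen {n} {k} (τ s) (i , x) with diffℕ s i <? k
... | yes p = i , flip x (fromℕ< p)
... | no _ = i , x

act : ∀ {n k} → List (Gen n) → Vertex n k → Vertex n k
act [] v = v
act (g ∷ w) v = actGen g (act w v)

-- α ∈ 𝒜 : elements of 𝒜 are exactly the actions of words in the generators

-- Every element of 𝒜 acts like a normal form τ_S ∘ ρ^c ∘ μ^e: positions move by i ↦ ±i + c, and the
-- bits are x (reversed if e) with the bits lying over the positions in S toggled; conversely every
-- normal form is realised by a word in the generators.  A normal form swapping (i , x) and (j , y)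
-- thus moves positions either by a reflection i ↦ c − i, which exchanges any i and j (take c = i + j),
-- or by a translation i ↦ i + c with 2c = 0, i.e. c = 0 or c = n/2.  The bits are then matched by a
-- single S exactly when the toggles needed over the window of j (turning x into y) agree on the
-- overlap M with those needed over the window of i (turning y into x): that is the bit condition.

module Submission where

open import Defs
open import Data.Bool using (Bool; true; false; not; _xor_; if_then_else_)
import Data.Bool.Properties as Bool
open import Data.Bool.Properties using (xor-assoc; xor-same; xor-comm; true-xor; xor-identityʳ)
open import Data.Empty using (⊥-elim)
open import Data.Fin as Fin using (Fin; toℕ; fromℕ<; fromℕ; inject₁; opposite)
open import Data.Fin.Properties
  using (opposite-prop; toℕ-fromℕ<; fromℕ<-toℕ; fromℕ<-cong; toℕ-injective; toℕ<n; opposite-involutive)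
open import Data.List using (List; []; _∷_; _++_; replicate; allFin)
open import Data.List.Membership.Propositional using (_∈_; _∉_)
open import Data.List.Membership.Propositional.Properties using (∈-allFin)
import Data.List.Relation.Unary.All as All
open import Data.List.Relation.Unary.AllPairs using (_∷_)
open import Data.List.Relation.Unary.Any using (here; there)
open import Data.List.Relation.Unary.Unique.Propositional using (Unique)
open import Data.List.Relation.Unary.Unique.Propositional.Properties using (allFin⁺)
open import Data.Nat using (ℕ; zero; suc; _+_; _∸_; _%_; _≤_; _<_; _<?_; s≤s⁻¹)
import Data.Nat.Properties as ℕ
open import Data.Nat.Properties
  using ( +-comm; +-assoc; +-identityʳ; m∸n+n≡m; m+[n∸m]≡n; <⇒≤; <-≤-trans
        ; m+n≡0⇒m≡0; ≮⇒≥; +-cancelʳ-<; +-mono-<)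
open import Data.Nat.DivMod
  using (_mod_; m%n<n; m%n%n≡m%n; n%n≡0; [m+n]%n≡m%n; m<n⇒m%n≡m; %-distribˡ-+)
open import Data.Nat.Tactic.RingSolver using (solve-∀)
open import Algebra.Properties.CommutativeSemigroup ℕ.+-commutativeSemigroup
  using (x∙yz≈yx∙z; x∙yz≈y∙zx; interchange)
open import Data.Product using (Σ; _×_; _,_; proj₁; proj₂)
open import Data.Sum using (_⊎_; inj₁; inj₂)
open import Data.Vec using (Vec; lookup; reverse; tabulate; updateAt; _∷ʳ_)
import Data.Vec as Vec
open import Data.Vec.Properties
  using (reverse-∷; lookup∘tabulate; tabulate∘lookup; tabulate-cong; lookup∘updateAt; lookup∘updateAt′)
open import Function using (_∘_)
open import Function.Bundles using (_⇔_; mk⇔; Equivalence)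
open import Function.Construct.Composition using (_⇔-∘_)
open import Function.Construct.Symmetry using (⇔-sym)
open import Level using (0ℓ)
open import Relation.Binary using (Setoid)
import Relation.Binary.Reasoning.Setoid as SetoidReasoning
open import Relation.Binary.PropositionalEquality
  using (_≡_; _≢_; refl; sym; trans; cong; cong₂; subst; module ≡-Reasoning)
open import Relation.Nullary using (yes; no; does)
open import Relation.Nullary.Decidable using (dec-true; dec-false; does-⇔)

private
  variable
    A : Set
    n : ℕ

xor-cancelˡ : ∀ a b → a xor (a xor b) ≡ b
xor-cancelˡ a b = trans (sym (xor-assoc a a b)) (cong (_xor b) (xor-same a))

≡⇒xor≡false : ∀ {a b} → a ≡ b → a xor b ≡ false
≡⇒xor≡false {a} refl = xor-same a

xor≡false⇒≡ : ∀ {a b} → a xor b ≡ false → a ≡ b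
xor≡false⇒≡ {true}  {true}  _ = refl
xor≡false⇒≡ {false} {false} _ = refl

≢⇒xor≡true : ∀ {a b} → a ≢ b → a xor b ≡ true
≢⇒xor≡true {true}  {true}  a≢b = ⊥-elim (a≢b refl)
≢⇒xor≡true {true}  {false} _   = refl
≢⇒xor≡true {false} {true}  _   = refl
≢⇒xor≡true {false} {false} a≢b = ⊥-elim (a≢b refl)

≡⇔≡⇔xor≡ : ∀ a b c d → ((a ≡ b) ⇔ (c ≡ d)) ⇔ (a xor b ≡ c xor d)
≡⇔≡⇔xor≡ a b c d = mk⇔ forward backward
  where
  forward : (a ≡ b) ⇔ (c ≡ d) → a xor b ≡ c xor d
  forward h with a Bool.≟ b
  ... | yes a≡b = trans (≡⇒xor≡false a≡b) (sym (≡⇒xor≡false (Equivalence.to h a≡b)))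
  ... | no a≢b  = trans (≢⇒xor≡true a≢b) (sym (≢⇒xor≡true (a≢b ∘ Equivalence.from h)))
  backward : a xor b ≡ c xor d → (a ≡ b) ⇔ (c ≡ d)
  backward e = mk⇔ (λ a≡b → xor≡false⇒≡ (trans (sym e) (≡⇒xor≡false a≡b)))
                   (λ c≡d → xor≡false⇒≡ (trans e (≡⇒xor≡false c≡d)))

lookup-∷ʳ-inject₁ : ∀ (xs : Vec A n) a i → lookup (xs ∷ʳ a) (inject₁ i) ≡ lookup xs i
lookup-∷ʳ-inject₁ (_ Vec.∷ _)  a Fin.zero    = refl
lookup-∷ʳ-inject₁ (_ Vec.∷ xs) a (Fin.suc i) = lookup-∷ʳ-inject₁ xs a i

lookup-∷ʳ-last : ∀ (xs : Vec A n) a → lookup (xs ∷ʳ a) (fromℕ n) ≡ a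
lookup-∷ʳ-last Vec.[]        a = refl
lookup-∷ʳ-last (_ Vec.∷ xs) a = lookup-∷ʳ-last xs a

lookup-reverse-opposite : ∀ (xs : Vec A n) i → lookup (reverse xs) (opposite i) ≡ lookup xs i
lookup-reverse-opposite (a Vec.∷ xs) Fin.zero rewrite reverse-∷ a xs = lookup-∷ʳ-last (reverse xs) a
lookup-reverse-opposite (a Vec.∷ xs) (Fin.suc i) rewrite reverse-∷ a xs =
  trans (lookup-∷ʳ-inject₁ (reverse xs) a (opposite i)) (lookup-reverse-opposite xs i)

lookup-reverse : ∀ (xs : Vec A n) i → lookup (reverse xs) i ≡ lookup xs (opposite i)
lookup-reverse xs i =
  trans (cong (lookup (reverse xs)) (sym (opposite-involutive i))) (lookup-reverse-opposite xs (opposite i))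

lookup-ext : ∀ {xs ys : Vec A n} → (∀ i → lookup xs i ≡ lookup ys i) → xs ≡ ys
lookup-ext {xs = xs} {ys} h = trans (sym (tabulate∘lookup xs)) (trans (tabulate-cong h) (tabulate∘lookup ys))

lookup-updateAt-not : ∀ (xs : Vec Bool n) i j → lookup (updateAt xs i not) j ≡ lookup xs j xor does (i Fin.≟ j)
lookup-updateAt-not xs i j with i Fin.≟ j
... | yes refl = trans (lookup∘updateAt i xs) (sym (trans (xor-comm _ true) (true-xor _)))
... | no i≢j   = trans (lookup∘updateAt′ j i (i≢j ∘ sym) xs) (sym (xor-identityʳ _))

toℕ-opposite+toℕ : (i : Fin (suc n)) → toℕ (opposite i) + toℕ i ≡ n
toℕ-opposite+toℕ i = trans (cong (_+ toℕ i) (opposite-prop i)) (m∸n+n≡m (s≤s⁻¹ (toℕ<n i)))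

≡toℕ⇒< : ∀ {a} (i : Fin n) → a ≡ toℕ i → a < n
≡toℕ⇒< i refl = toℕ<n i

fromℕ<-≡ : ∀ {a} (a<n : a < n) {i : Fin n} → a ≡ toℕ i → fromℕ< a<n ≡ i
fromℕ<-≡ a<n {i} a≡i = trans (fromℕ<-cong _ _ a≡i a<n (toℕ<n i)) (fromℕ<-toℕ i (toℕ<n i))

fromℕ<≡⇔≡toℕ : ∀ {a} (a<n : a < n) (i : Fin n) → (fromℕ< a<n ≡ i) ⇔ (a ≡ toℕ i)
fromℕ<≡⇔≡toℕ a<n i = mk⇔ (λ e → trans (sym (toℕ-fromℕ< a<n)) (cong toℕ e)) (fromℕ<-≡ a<n)

module Modular (n′ : ℕ) where

  N : ℕ
  N = suc n′

  infix 4 _≈_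
  record _≈_ (a b : ℕ) : Set where
    constructor ≈-by-%
    field %-≡ : a % N ≡ b % N

  ≈-setoid : Setoid 0ℓ 0ℓ
  ≈-setoid = record
    { Carrier = ℕ
    ; _≈_ = _≈_
    ; isEquivalence = record
      { refl  = ≈-by-% refl
      ; sym   = λ (≈-by-% e) → ≈-by-% (sym e)
      ; trans = λ (≈-by-% e) (≈-by-% f) → ≈-by-% (trans e f)
      }
    }

  open Setoid ≈-setoid public
    using () renaming (refl to ≈-refl; sym to ≈-sym; trans to ≈-trans; reflexive to ≡⇒≈)
  module ≈-Reasoning = SetoidReasoning ≈-setoid
  open ≈-Reasoning

  [_] : ℕ → Fin N
  [ a ] = a mod N

  +-cong : ∀ {a b c d} → a ≈ b → c ≈ d → a + c ≈ b + d
  +-cong {a} {b} {c} {d} (≈-by-% a≈b) (≈-by-% c≈d) = ≈-by-% (trans (%-distribˡ-+ a c N)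
    (trans (cong₂ (λ u v → (u + v) % N) a≈b c≈d) (sym (%-distribˡ-+ b d N))))

  +-congˡ : ∀ a {c d} → c ≈ d → a + c ≈ a + d
  +-congˡ a = +-cong ≈-refl

  +-congʳ : ∀ {a b} c → a ≈ b → a + c ≈ b + c
  +-congʳ c a≈b = +-cong a≈b ≈-refl

  %-≈ : ∀ a → a % N ≈ a
  %-≈ a = ≈-by-% (m%n%n≡m%n a N)

  N≈0 : N ≈ 0
  N≈0 = ≈-by-% (n%n≡0 N)

  toℕ-[] : ∀ a → toℕ [ a ] ≈ a
  toℕ-[] a = ≈-by-% (trans (cong (_% N) (toℕ-fromℕ< (m%n<n a N))) (m%n%n≡m%n a N))

  []-toℕ : ∀ i → [ toℕ i ] ≡ i
  []-toℕ i = toℕ-injective (trans (toℕ-fromℕ< _) (m<n⇒m%n≡m (toℕ<n i)))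

  []-cong : ∀ {a b} → a ≈ b → [ a ] ≡ [ b ]
  []-cong (≈-by-% a≈b) = toℕ-injective (trans (toℕ-fromℕ< _) (trans a≈b (sym (toℕ-fromℕ< _))))

  []≡⇔≈ : ∀ a i → ([ a ] ≡ i) ⇔ (a ≈ toℕ i)
  []≡⇔≈ a i = mk⇔ (λ { refl → ≈-sym (toℕ-[] a) }) (λ a≈i → trans ([]-cong a≈i) ([]-toℕ i))

  addMod-identityʳ : ∀ i → addMod i 0 ≡ i
  addMod-identityʳ i = trans ([]-cong (≡⇒≈ (+-identityʳ (toℕ i)))) ([]-toℕ i)

  -[]-inverseˡ : ∀ a → (N ∸ toℕ [ a ]) + a ≈ 0
  -[]-inverseˡ a = begin
    (N ∸ toℕ [ a ]) + a         ≈⟨ +-congˡ (N ∸ toℕ [ a ]) (toℕ-[] a) ⟨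
    (N ∸ toℕ [ a ]) + toℕ [ a ] ≡⟨ m∸n+n≡m (<⇒≤ (toℕ<n [ a ])) ⟩
    N                           ≈⟨ N≈0 ⟩
    0                           ∎

  +-cancelʳ : ∀ a b c → a + c ≈ b + c → a ≈ b
  +-cancelʳ a b c a+c≈b+c = begin
    a                      ≡⟨ +-identityʳ a ⟨
    a + 0                  ≈⟨ +-congˡ a (-[]-inverseˡ c) ⟨
    a + (c⁻ + c)           ≡⟨ shuffle a ⟩
    (a + c) + c⁻           ≈⟨ +-congʳ c⁻ a+c≈b+c ⟩
    (b + c) + c⁻           ≡⟨ shuffle b ⟨
    b + (c⁻ + c)           ≈⟨ +-congˡ b (-[]-inverseˡ c) ⟩
    b + 0                  ≡⟨ +-identityʳ b ⟩
    b                      ∎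
    where
    c⁻ : ℕ
    c⁻ = N ∸ toℕ [ c ]
    shuffle : ∀ x → x + (c⁻ + c) ≡ (x + c) + c⁻
    shuffle x = trans (cong (x +_) (+-comm c⁻ c)) (sym (+-assoc x c c⁻))

  move-+ʳ : ∀ a b c → a + b ≈ c → a ≈ (N ∸ toℕ [ b ]) + c
  move-+ʳ a b c a+b≈c = +-cancelʳ a ((N ∸ toℕ [ b ]) + c) b (begin
    a + b                      ≈⟨ a+b≈c ⟩
    c                          ≡⟨ +-identityʳ c ⟨
    c + 0                      ≈⟨ +-congˡ c (-[]-inverseˡ b) ⟨
    c + ((N ∸ toℕ [ b ]) + b)  ≡⟨ x∙yz≈yx∙z c (N ∸ toℕ [ b ]) b ⟩
    ((N ∸ toℕ [ b ]) + c) + b  ∎)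

  N+-≈ : ∀ a → N + a ≈ a
  N+-≈ a = ≈-by-% (trans (cong (_% N) (+-comm N a)) ([m+n]%n≡m%n a N))

  diffℕ≡⇔≈ : ∀ m i {t} → t < N → (diffℕ m i ≡ t) ⇔ (toℕ m + (N ∸ toℕ i) ≈ t)
  diffℕ≡⇔≈ m i t<N = mk⇔ (λ d≡t → ≈-by-% (trans d≡t (sym (m<n⇒m%n≡m t<N))))
                          (λ (≈-by-% e) → trans e (m<n⇒m%n≡m t<N))

  -- Bit t of a vertex at position a lies over position a + t, and diffℕ m a recovers t from m.
  window : ∀ a m {t} → t < N → ([ a + t ] ≡ m) ⇔ (diffℕ m [ a ] ≡ t)
  window a m {t} t<N = ⇔-sym (diffℕ≡⇔≈ m [ a ] t<N) ⇔-∘ (mk⇔ to from ⇔-∘ []≡⇔≈ (a + t) m)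
    where
    a⁻ : ℕ
    a⁻ = N ∸ toℕ [ a ]
    to : a + t ≈ toℕ m → toℕ m + a⁻ ≈ t
    to a+t≈m = ≈-sym (begin
      t             ≈⟨ move-+ʳ t a (toℕ m) (≈-trans (≡⇒≈ (+-comm t a)) a+t≈m) ⟩
      a⁻ + toℕ m    ≡⟨ +-comm a⁻ (toℕ m) ⟩
      toℕ m + a⁻    ∎)
    from : toℕ m + a⁻ ≈ t → a + t ≈ toℕ m
    from m+a⁻≈t = begin
      a + t            ≈⟨ +-congˡ a m+a⁻≈t ⟨
      a + (toℕ m + a⁻) ≡⟨ x∙yz≈y∙zx a (toℕ m) a⁻ ⟩
      toℕ m + (a⁻ + a) ≈⟨ +-congˡ (toℕ m) (-[]-inverseˡ a) ⟩
      toℕ m + 0        ≡⟨ +-identityʳ (toℕ m) ⟩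
      toℕ m            ∎

  double≈0⇒N≡double : ∀ h → h < N → h ≢ 0 → h + h ≈ 0 → N ≡ h + h
  double≈0⇒N≡double h h<N h≢0 (≈-by-% 2h≈0) with h + h <? N
  ... | yes 2h<N = ⊥-elim (h≢0 (m+n≡0⇒m≡0 h (trans (sym (m<n⇒m%n≡m 2h<N)) 2h≈0)))
  ... | no 2h≮N = trans (cong (_+ N) (sym d≡0)) (sym 2h≡d+N)
    where
    d : ℕ
    d = h + h ∸ N
    2h≡d+N : h + h ≡ d + N
    2h≡d+N = sym (m∸n+n≡m (≮⇒≥ 2h≮N))
    d<N : d < N
    d<N = +-cancelʳ-< N d N (subst (_< N + N) 2h≡d+N (+-mono-< h<N h<N))
    d≡0 : d ≡ 0
    d≡0 = trans (sym (m<n⇒m%n≡m d<N))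
            (trans (sym ([m+n]%n≡m%n d N)) (trans (cong (_% N) (sym 2h≡d+N)) 2h≈0))

  addMod-swap⇒double≈0 : ∀ {i j} c → addMod i c ≡ j → addMod j c ≡ i → c + c ≈ 0
  addMod-swap⇒double≈0 {i} {j} c i+c≡j j+c≡i = +-cancelʳ (c + c) 0 (toℕ i) (begin
    (c + c) + toℕ i  ≡⟨ trans (+-comm (c + c) (toℕ i)) (sym (+-assoc (toℕ i) c c)) ⟩
    (toℕ i + c) + c  ≈⟨ +-congʳ c (Equivalence.to ([]≡⇔≈ (toℕ i + c) j) i+c≡j) ⟩
    toℕ j + c        ≈⟨ Equivalence.to ([]≡⇔≈ (toℕ j + c) i) j+c≡i ⟩
    toℕ i            ∎)

  addMod-swap : ∀ {i j} c → addMod i c ≡ j → addMod j c ≡ i →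
                j ≡ i ⊎ Σ ℕ λ h → N ≡ h + h × j ≡ addMod i h
  addMod-swap {i} {j} c i+c≡j j+c≡i with c % N ℕ.≟ 0
  ... | yes c%N≡0 =
    inj₁ (trans (sym i+c≡j) (trans ([]-cong (+-congˡ (toℕ i) (≈-by-% c%N≡0))) (addMod-identityʳ i)))
  ... | no c%N≢0  = inj₂ (c % N , double≈0⇒N≡double (c % N) (m%n<n c N) c%N≢0 2c%N≈0 ,
                          trans (sym i+c≡j) ([]-cong (+-congˡ (toℕ i) (≈-sym (%-≈ c)))))
    where
    2c%N≈0 : c % N + c % N ≈ 0
    2c%N≈0 = ≈-trans (+-cong (%-≈ c) (%-≈ c)) (addMod-swap⇒double≈0 c i+c≡j j+c≡i)

  addMod-half-turn : ∀ {h} → N ≡ h + h → ∀ i → addMod (addMod i h) h ≡ i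
  addMod-half-turn {h} N≡2h i = trans ([]-cong (begin
    toℕ (addMod i h) + h  ≈⟨ +-congʳ h (toℕ-[] (toℕ i + h)) ⟩
    (toℕ i + h) + h       ≡⟨ trans (+-assoc (toℕ i) h h) (cong (toℕ i +_) (sym N≡2h)) ⟩
    toℕ i + N             ≡⟨ +-comm (toℕ i) N ⟩
    N + toℕ i             ≈⟨ N+-≈ (toℕ i) ⟩
    toℕ i                 ∎)) ([]-toℕ i)

  reflect-swap : ∀ i j → [ (N ∸ toℕ i) + (toℕ i + toℕ j) ] ≡ j
  reflect-swap i j = trans ([]-cong (begin
    (N ∸ toℕ i) + (toℕ i + toℕ j)  ≡⟨ sym (+-assoc (N ∸ toℕ i) (toℕ i) (toℕ j)) ⟩
    (N ∸ toℕ i) + toℕ i + toℕ j    ≡⟨ cong (_+ toℕ j) (m∸n+n≡m (<⇒≤ (toℕ<n i))) ⟩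
    N + toℕ j                      ≈⟨ N+-≈ (toℕ j) ⟩
    toℕ j                          ∎)) ([]-toℕ j)

module Action (n′ k′ : ℕ) (k≤N : suc k′ ≤ suc n′) where

  open Modular n′

  k : ℕ
  k = suc k′

  toℕ<N : (t : Fin k) → toℕ t < N
  toℕ<N t = <-≤-trans (toℕ<n t) k≤N

  signed : Bool → Fin N → ℕ
  signed false i = toℕ i
  signed true  i = N ∸ toℕ i

  signed-inverse : ∀ e i → signed e i + signed (not e) i ≡ N
  signed-inverse false i = m+[n∸m]≡n (<⇒≤ (toℕ<n i))
  signed-inverse true  i = m∸n+n≡m (<⇒≤ (toℕ<n i))

  orient : Bool → Vec Bool k → Vec Bool k
  orient false x = x
  orient true  x = reverse x

  lookup-orient-opposite : ∀ e x t → lookup (orient e x) (opposite t) ≡ lookup (orient (not e) x) t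
  lookup-orient-opposite false x t = sym (lookup-reverse x t)
  lookup-orient-opposite true  x t = lookup-reverse-opposite x t

  -- nf e c S acts as μ^e, then ρ^c, then τ_m for every m with S m.
  record Normal : Set where
    constructor nf
    field
      reflected : Bool
      shift     : ℕ
      flips     : Fin N → Bool

  ⟦_⟧ : Normal → Vertex N k → Vertex N k
  ⟦ nf e c S ⟧ (i , x) =
    [ signed e i + c ] , tabulate λ t → lookup (orient e x) t xor S [ signed e i + c + toℕ t ]

  ⟦⟧≡⇔ : ∀ e c S i j x y →
    (⟦ nf e c S ⟧ (i , x) ≡ (j , y)) ⇔
    ([ signed e i + c ] ≡ j ×
     (∀ m (t : Fin k) → diffℕ m j ≡ toℕ t → lookup (orient e x) t xor S m ≡ lookup y t))
  ⟦⟧≡⇔ e c S i j x y = mk⇔ to from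
    where
    P : ℕ
    P = signed e i + c
    F : Fin k → Bool
    F t = lookup (orient e x) t xor S [ P + toℕ t ]
    lands-on : [ P ] ≡ j → ∀ m (t : Fin k) → diffℕ m j ≡ toℕ t → [ P + toℕ t ] ≡ m
    lands-on P≡j m t d = Equivalence.from (window P m (toℕ<N t)) (trans (cong (diffℕ m) P≡j) d)
    offset : [ P ] ≡ j → (t : Fin k) → diffℕ [ P + toℕ t ] j ≡ toℕ t
    offset P≡j t = trans (cong (diffℕ [ P + toℕ t ]) (sym P≡j)) (Equivalence.to (window P _ (toℕ<N t)) refl)
    Target : Set
    Target = [ P ] ≡ j × (∀ m (t : Fin k) → diffℕ m j ≡ toℕ t → lookup (orient e x) t xor S m ≡ lookup y t)
    to : ⟦ nf e c S ⟧ (i , x) ≡ (j , y) → Target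
    to eq = cong proj₁ eq , λ m t d → begin
      lookup (orient e x) t xor S m ≡⟨ cong (λ m′ → lookup (orient e x) t xor S m′) (lands-on (cong proj₁ eq) m t d) ⟨
      F t                           ≡⟨ lookup∘tabulate F t ⟨
      lookup (tabulate F) t         ≡⟨ cong (λ v → lookup (proj₂ v) t) eq ⟩
      lookup y t                    ∎
      where open ≡-Reasoning
    from : Target → ⟦ nf e c S ⟧ (i , x) ≡ (j , y)
    from (P≡j , bits) = cong₂ _,_ P≡j (lookup-ext λ t →
      trans (lookup∘tabulate F t) (bits [ P + toℕ t ] t (offset P≡j t)))

  translated : ℕ → ℕ → Normal → Normal
  translated d d′ (nf e c S) = nf e (c + d) (λ m → S [ toℕ m + d′ ])

  -- μ negates positions and reverses the windows, so a toggle over position m becomes one over k′ − m.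
  _·_ : Gen N → Normal → Normal
  ρ   · g        = translated 1 n′ g
  ρ⁻¹ · g        = translated n′ 1 g
  μ   · nf e c S = nf (not e) (N ∸ toℕ [ c ]) (λ m → S [ (N ∸ toℕ m) + k′ ])
  τ s · nf e c S = nf e c (λ m → S m xor does (m Fin.≟ s))

  translate : ℕ → Vertex N k → Vertex N k
  translate d (i , x) = addMod i d , x

  translate-⟦⟧ : ∀ d d′ → d + d′ ≈ 0 → ∀ g v → translate d (⟦ g ⟧ v) ≡ ⟦ translated d d′ g ⟧ v
  translate-⟦⟧ d d′ d+d′≈0 (nf e c S) (i , x) = cong₂ _,_ ([]-cong position)
    (tabulate-cong λ t → cong (λ m → lookup (orient e x) t xor S m) ([]-cong (bit t)))
    where
    open ≈-Reasoning
    P : ℕ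
    P = signed e i + c
    position : toℕ [ P ] + d ≈ signed e i + (c + d)
    position = begin
      toℕ [ P ] + d       ≈⟨ +-congʳ d (toℕ-[] P) ⟩
      P + d               ≡⟨ +-assoc (signed e i) c d ⟩
      signed e i + (c + d) ∎
    regroup : ∀ s c d t d′ → s + (c + d) + t + d′ ≡ (s + c + t) + (d + d′)
    regroup = solve-∀
    bit : ∀ t → P + toℕ t ≈ toℕ [ signed e i + (c + d) + toℕ t ] + d′
    bit t = ≈-sym (begin
      toℕ [ signed e i + (c + d) + toℕ t ] + d′ ≈⟨ +-congʳ d′ (toℕ-[] _) ⟩
      signed e i + (c + d) + toℕ t + d′         ≡⟨ regroup (signed e i) c d (toℕ t) d′ ⟩
      (P + toℕ t) + (d + d′)                    ≈⟨ +-congˡ (P + toℕ t) d+d′≈0 ⟩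
      (P + toℕ t) + 0                           ≡⟨ +-identityʳ (P + toℕ t) ⟩
      P + toℕ t                                 ∎)

  μ-⟦⟧ : ∀ g v → actGen μ (⟦ g ⟧ v) ≡ ⟦ μ · g ⟧ v
  μ-⟦⟧ (nf e c S) (i , x) = cong₂ _,_ ([]-cong position) (lookup-ext bit)
    where
    P : ℕ
    P = signed e i + c
    P′ : ℕ
    P′ = signed (not e) i + (N ∸ toℕ [ c ])
    F : Fin k → Bool
    F t = lookup (orient e x) t xor S [ P + toℕ t ]
    F′ : Fin k → Bool
    F′ t = lookup (orient (not e) x) t xor S [ (N ∸ toℕ [ P′ + toℕ t ]) + k′ ]
    P+P′≈0 : P + P′ ≈ 0
    P+P′≈0 = begin
      P + P′
        ≡⟨ interchange (signed e i) c (signed (not e) i) (N ∸ toℕ [ c ]) ⟩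
      (signed e i + signed (not e) i) + (c + (N ∸ toℕ [ c ]))
        ≈⟨ +-cong (≡⇒≈ (signed-inverse e i)) (≈-trans (≡⇒≈ (+-comm c (N ∸ toℕ [ c ]))) (-[]-inverseˡ c)) ⟩
      N + 0
        ≈⟨ N+-≈ 0 ⟩
      0 ∎
      where open ≈-Reasoning
    position : N ∸ toℕ [ P ] ≈ P′
    position = ≈-sym (≈-trans (move-+ʳ P′ P 0 (≈-trans (≡⇒≈ (+-comm P′ P)) P+P′≈0)) (≡⇒≈ (+-identityʳ _)))
    bit-position : ∀ t → P + toℕ (opposite t) ≈ (N ∸ toℕ [ P′ + toℕ t ]) + k′
    bit-position t = move-+ʳ (P + toℕ (opposite t)) (P′ + toℕ t) k′ (begin
      (P + toℕ (opposite t)) + (P′ + toℕ t) ≡⟨ interchange P (toℕ (opposite t)) P′ (toℕ t) ⟩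
      (P + P′) + (toℕ (opposite t) + toℕ t) ≈⟨ +-cong P+P′≈0 (≡⇒≈ (toℕ-opposite+toℕ t)) ⟩
      k′                                    ∎)
      where open ≈-Reasoning
    bit : ∀ t → lookup (reverse (tabulate F)) t ≡ lookup (tabulate F′) t
    bit t = begin
      lookup (reverse (tabulate F)) t ≡⟨ lookup-reverse (tabulate F) t ⟩
      lookup (tabulate F) (opposite t) ≡⟨ lookup∘tabulate F (opposite t) ⟩
      F (opposite t)                  ≡⟨ cong₂ _xor_ (lookup-orient-opposite e x t) (cong S ([]-cong (bit-position t))) ⟩
      F′ t                            ≡⟨ lookup∘tabulate F′ t ⟨
      lookup (tabulate F′) t          ∎
      where open ≡-Reasoning

  toggles : Fin N → Fin N → Fin k → Bool
  toggles s i t = does (diffℕ s i ℕ.≟ toℕ t)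

  toggled : Fin N → Fin N → Vec Bool k → Vec Bool k
  toggled s i x = tabulate λ t → lookup x t xor toggles s i t

  actGen-τ : ∀ s i x → actGen (τ s) (i , x) ≡ (i , toggled s i x)
  actGen-τ s i x with diffℕ s i <? k
  ... | yes d<k = cong (i ,_) (lookup-ext λ t → begin
    lookup (updateAt x (fromℕ< d<k) not) t    ≡⟨ lookup-updateAt-not x (fromℕ< d<k) t ⟩
    lookup x t xor does (fromℕ< d<k Fin.≟ t)
      ≡⟨ cong (lookup x t xor_) (does-⇔ (fromℕ<≡⇔≡toℕ d<k t) (fromℕ< d<k Fin.≟ t) (diffℕ s i ℕ.≟ toℕ t)) ⟩
    lookup x t xor toggles s i t              ≡⟨ lookup∘tabulate (λ t → lookup x t xor toggles s i t) t ⟨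
    lookup (toggled s i x) t                  ∎)
    where open ≡-Reasoning
  ... | no d≮k = cong (i ,_) (lookup-ext λ t → begin
    lookup x t                                ≡⟨ xor-identityʳ (lookup x t) ⟨
    lookup x t xor false                      ≡⟨ cong (lookup x t xor_) (dec-false (diffℕ s i ℕ.≟ toℕ t) (d≮k ∘ ≡toℕ⇒< t)) ⟨
    lookup x t xor toggles s i t              ≡⟨ lookup∘tabulate (λ t → lookup x t xor toggles s i t) t ⟨
    lookup (toggled s i x) t                  ∎)
    where open ≡-Reasoning

  τ-⟦⟧ : ∀ s g v → actGen (τ s) (⟦ g ⟧ v) ≡ ⟦ τ s · g ⟧ v
  τ-⟦⟧ s (nf e c S) (i , x) = trans (actGen-τ s [ P ] (tabulate F)) (cong ([ P ] ,_) (tabulate-cong λ t → begin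
    lookup (tabulate F) t xor toggles s [ P ] t
      ≡⟨ cong (_xor toggles s [ P ] t) (lookup∘tabulate F t) ⟩
    F t xor toggles s [ P ] t
      ≡⟨ xor-assoc (lookup (orient e x) t) (S [ P + toℕ t ]) (toggles s [ P ] t) ⟩
    lookup (orient e x) t xor (S [ P + toℕ t ] xor toggles s [ P ] t)
      ≡⟨ cong (λ b → lookup (orient e x) t xor (S [ P + toℕ t ] xor b))
              (does-⇔ (⇔-sym (window P s (toℕ<N t))) (diffℕ s [ P ] ℕ.≟ toℕ t) ([ P + toℕ t ] Fin.≟ s)) ⟩
    lookup (orient e x) t xor (S [ P + toℕ t ] xor does ([ P + toℕ t ] Fin.≟ s)) ∎))
    where
    open ≡-Reasoning
    P : ℕ
    P = signed e i + c
    F : Fin k → Bool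
    F t = lookup (orient e x) t xor S [ P + toℕ t ]

  actGen-⟦⟧ : ∀ g h v → actGen g (⟦ h ⟧ v) ≡ ⟦ g · h ⟧ v
  actGen-⟦⟧ ρ     h (i , x) = translate-⟦⟧ 1 n′ N≈0 h (i , x)
  actGen-⟦⟧ ρ⁻¹   h (i , x) = translate-⟦⟧ n′ 1 (≈-trans (≡⇒≈ (+-comm n′ 1)) N≈0) h (i , x)
  actGen-⟦⟧ μ     h v       = μ-⟦⟧ h v
  actGen-⟦⟧ (τ s) h v       = τ-⟦⟧ s h v

  identity : Normal
  identity = nf false 0 (λ _ → false)

  ⟦identity⟧ : ∀ v → ⟦ identity ⟧ v ≡ v
  ⟦identity⟧ (i , x) = cong₂ _,_ (addMod-identityʳ i)
    (trans (tabulate-cong λ t → xor-identityʳ (lookup x t)) (tabulate∘lookup x))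

  normalise : List (Gen N) → Normal
  normalise []      = identity
  normalise (g ∷ w) = g · normalise w

  act≡⟦normalise⟧ : ∀ w v → act w v ≡ ⟦ normalise w ⟧ v
  act≡⟦normalise⟧ []      v = sym (⟦identity⟧ v)
  act≡⟦normalise⟧ (g ∷ w) v = trans (cong (actGen g) (act≡⟦normalise⟧ w v)) (actGen-⟦⟧ g (normalise w) v)

  ⟦⟧-cong : ∀ e {c c′ S S′} → c ≈ c′ → (∀ m → S m ≡ S′ m) → ∀ v → ⟦ nf e c S ⟧ v ≡ ⟦ nf e c′ S′ ⟧ v
  ⟦⟧-cong e {S′ = S′} c≈c′ S≗S′ (i , x) = cong₂ _,_ ([]-cong (+-congˡ (signed e i) c≈c′))
    (tabulate-cong λ t → cong (lookup (orient e x) t xor_)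
      (trans (S≗S′ _) (cong S′ ([]-cong (+-congʳ (toℕ t) (+-congˡ (signed e i) c≈c′))))))

  flipWord : (Fin N → Bool) → List (Fin N) → List (Gen N)
  flipWord T []      = []
  flipWord T (s ∷ l) = if T s then τ s ∷ flipWord T l else flipWord T l

  flipsAlong : (Fin N → Bool) → List (Fin N) → Fin N → Bool
  flipsAlong T []      m = false
  flipsAlong T (s ∷ l) m = if T s then flipsAlong T l m xor does (m Fin.≟ s) else flipsAlong T l m

  flipsAlong-∉ : ∀ T l {m} → m ∉ l → flipsAlong T l m ≡ false
  flipsAlong-∉ T []      m∉l = refl
  flipsAlong-∉ T (s ∷ l) {m} m∉l with T s
  ... | true  = cong₂ _xor_ (flipsAlong-∉ T l (m∉l ∘ there)) (dec-false (m Fin.≟ s) (m∉l ∘ here))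
  ... | false = flipsAlong-∉ T l (m∉l ∘ there)

  flipsAlong-∈ : ∀ T {l} → Unique l → ∀ {m} → m ∈ l → flipsAlong T l m ≡ T m
  flipsAlong-∈ T {s ∷ l} (s∉l ∷ _) (here refl) with T s
  ... | true  = cong₂ _xor_ (flipsAlong-∉ T l (λ s∈l → All.lookup s∉l s∈l refl)) (dec-true (s Fin.≟ s) refl)
  ... | false = flipsAlong-∉ T l (λ s∈l → All.lookup s∉l s∈l refl)
  flipsAlong-∈ T {s ∷ l} (s∉l ∷ unique) {m} (there m∈l) with T s
  ... | true  = trans (cong₂ _xor_ (flipsAlong-∈ T unique m∈l) (dec-false (m Fin.≟ s) (All.lookup s∉l m∈l ∘ sym)))
                      (xor-identityʳ (T m))
  ... | false = flipsAlong-∈ T unique m∈l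

  normalise-flipWord : ∀ T l w {e c} → normalise w ≡ nf e c (λ _ → false) →
                       normalise (flipWord T l ++ w) ≡ nf e c (flipsAlong T l)
  normalise-flipWord T []      w eq = eq
  normalise-flipWord T (s ∷ l) w eq with T s
  ... | true  = cong (τ s ·_) (normalise-flipWord T l w eq)
  ... | false = normalise-flipWord T l w eq

  normalise-ρs : ∀ r w {e c} → normalise w ≡ nf e c (λ _ → false) →
                 normalise (replicate r ρ ++ w) ≡ nf e (c + r) (λ _ → false)
  normalise-ρs zero    w {e} {c} eq = trans eq (cong (λ c′ → nf e c′ (λ _ → false)) (sym (+-identityʳ c)))
  normalise-ρs (suc r) w {e} {c} eq = trans (cong (ρ ·_) (normalise-ρs r w eq))
    (cong (λ c′ → nf e c′ (λ _ → false)) (trans (+-assoc c r 1) (cong (c +_) (+-comm r 1))))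

  reflection : Bool → List (Gen N)
  reflection false = []
  reflection true  = μ ∷ []

  reflectionShift : Bool → ℕ
  reflectionShift false = 0
  reflectionShift true  = N

  normalise-reflection : ∀ e → normalise (reflection e) ≡ nf e (reflectionShift e) (λ _ → false)
  normalise-reflection false = refl
  normalise-reflection true  = refl

  reflectionShift≈0 : ∀ e → reflectionShift e ≈ 0
  reflectionShift≈0 false = ≈-refl
  reflectionShift≈0 true  = N≈0

  realise : Normal → List (Gen N)
  realise (nf e c T) = flipWord T (allFin N) ++ replicate c ρ ++ reflection e

  act-realise : ∀ g v → act (realise g) v ≡ ⟦ g ⟧ v
  act-realise (nf e c T) v = begin
    act (realise (nf e c T)) v                                     ≡⟨ act≡⟦normalise⟧ (realise (nf e c T)) v ⟩
    ⟦ normalise (realise (nf e c T)) ⟧ v                           ≡⟨ cong (λ g → ⟦ g ⟧ v) normal-form ⟩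
    ⟦ nf e (reflectionShift e + c) (flipsAlong T (allFin N)) ⟧ v   ≡⟨ ⟦⟧-cong e shift≈c flips≗T v ⟩
    ⟦ nf e c T ⟧ v                                                 ∎
    where
    open ≡-Reasoning
    normal-form : normalise (realise (nf e c T)) ≡ nf e (reflectionShift e + c) (flipsAlong T (allFin N))
    normal-form = normalise-flipWord T (allFin N) _ (normalise-ρs c (reflection e) (normalise-reflection e))
    shift≈c : reflectionShift e + c ≈ c
    shift≈c = +-congʳ c (reflectionShift≈0 e)
    flips≗T : ∀ m → flipsAlong T (allFin N) m ≡ T m
    flips≗T m = flipsAlong-∈ T (allFin⁺ N) (∈-allFin m)

  Compatible : (Vec Bool k → Vec Bool k) → Fin N → Fin N → Vec Bool k → Vec Bool k → Set
  Compatible f i j x y = (m : Fin N) (p : diffℕ m i < k) (q : diffℕ m j < k) →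
    (lookup (f x) (fromℕ< q) ≡ lookup y (fromℕ< q)) ⇔ (lookup (f y) (fromℕ< p) ≡ lookup x (fromℕ< p))

  swap⇒compatible : ∀ e c S {i j x y} → ⟦ nf e c S ⟧ (i , x) ≡ (j , y) → ⟦ nf e c S ⟧ (j , y) ≡ (i , x) →
                    Compatible (orient e) i j x y
  swap⇒compatible e c S i↦j j↦i m p q =
    Equivalence.from (≡⇔≡⇔xor≡ _ _ _ _) (trans (toggle-at i↦j q) (sym (toggle-at j↦i p)))
    where
    toggle-at : ∀ {i j x y} → ⟦ nf e c S ⟧ (i , x) ≡ (j , y) → (q : diffℕ m j < k) →
                lookup (orient e x) (fromℕ< q) xor lookup y (fromℕ< q) ≡ S m
    toggle-at {i} {j} {x} {y} i↦j q =
      trans (cong (lookup (orient e x) (fromℕ< q) xor_) (sym bit)) (xor-cancelˡ (lookup (orient e x) (fromℕ< q)) (S m))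
      where
      bit : lookup (orient e x) (fromℕ< q) xor S m ≡ lookup y (fromℕ< q)
      bit = proj₂ (Equivalence.to (⟦⟧≡⇔ e c S i j x y) i↦j) m (fromℕ< q) (sym (toℕ-fromℕ< q))

  compatible⇒swap : ∀ e c {i j x y} → [ signed e i + c ] ≡ j → [ signed e j + c ] ≡ i →
                    Compatible (orient e) i j x y →
                    Σ (Fin N → Bool) λ S → ⟦ nf e c S ⟧ (i , x) ≡ (j , y) × ⟦ nf e c S ⟧ (j , y) ≡ (i , x)
  compatible⇒swap e c {i} {j} {x} {y} i↦j j↦i compatible =
    S , Equivalence.from (⟦⟧≡⇔ e c S i j x y) (i↦j , toward-y) ,
        Equivalence.from (⟦⟧≡⇔ e c S j i y x) (j↦i , toward-x)
    where
    -- Over the window of j, S records where y differs from orient e x; over the rest of the window of i,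
    -- where x differs from orient e y.  Compatibility says both records agree on the overlap.
    S : Fin N → Bool
    S m with diffℕ m j <? k | diffℕ m i <? k
    ... | yes q | _     = lookup (orient e x) (fromℕ< q) xor lookup y (fromℕ< q)
    ... | no _  | yes p = lookup (orient e y) (fromℕ< p) xor lookup x (fromℕ< p)
    ... | no _  | no _  = false

    cancel-at : ∀ (u v : Vec Bool k) {a} (a<k : a < k) (t : Fin k) → a ≡ toℕ t →
                lookup u t xor (lookup u (fromℕ< a<k) xor lookup v (fromℕ< a<k)) ≡ lookup v t
    cancel-at u v a<k t a≡t rewrite fromℕ<-≡ a<k a≡t = xor-cancelˡ (lookup u t) (lookup v t)

    on-overlap : ∀ m (p : diffℕ m i < k) (q : diffℕ m j < k) →
              lookup (orient e x) (fromℕ< q) xor lookup y (fromℕ< q) ≡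
              lookup (orient e y) (fromℕ< p) xor lookup x (fromℕ< p)
    on-overlap m p q = Equivalence.to (≡⇔≡⇔xor≡ _ _ _ _) (compatible m p q)

    toward-y : ∀ m t → diffℕ m j ≡ toℕ t → lookup (orient e x) t xor S m ≡ lookup y t
    toward-y m t d with diffℕ m j <? k | diffℕ m i <? k
    ... | yes q | _ = cancel-at (orient e x) y q t d
    ... | no ¬q  | _ = ⊥-elim (¬q (≡toℕ⇒< t d))

    toward-x : ∀ m t → diffℕ m i ≡ toℕ t → lookup (orient e y) t xor S m ≡ lookup x t
    toward-x m t d with diffℕ m j <? k | diffℕ m i <? k
    ... | yes q | _     = trans (cong (lookup (orient e y) t xor_) (on-overlap m (≡toℕ⇒< t d) q))
                                (cancel-at (orient e y) x (≡toℕ⇒< t d) t d)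
    ... | no _  | yes p = cancel-at (orient e y) x p t d
    ... | no _  | no ¬p  = ⊥-elim (¬p (≡toℕ⇒< t d))

  Swappable : Vertex N k → Vertex N k → Set
  Swappable u v = Σ (List (Gen N)) λ α → act α u ≡ v × act α v ≡ u

  CompatibleMotion : Fin N → Fin N → Vec Bool k → Vec Bool k → Set
  CompatibleMotion i j x y = Σ Bool λ e → Σ ℕ λ c →
    [ signed e i + c ] ≡ j × [ signed e j + c ] ≡ i × Compatible (orient e) i j x y

  swappable⇔compatibleMotion : ∀ i j x y → Swappable (i , x) (j , y) ⇔ CompatibleMotion i j x y
  swappable⇔compatibleMotion i j x y = mk⇔ to from
    where
    by-normal : ∀ g → ⟦ g ⟧ (i , x) ≡ (j , y) → ⟦ g ⟧ (j , y) ≡ (i , x) → CompatibleMotion i j x y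
    by-normal (nf e c S) i↦j j↦i = e , c , cong proj₁ i↦j , cong proj₁ j↦i , swap⇒compatible e c S i↦j j↦i
    to : Swappable (i , x) (j , y) → CompatibleMotion i j x y
    to (α , i↦j , j↦i) = by-normal (normalise α)
      (trans (sym (act≡⟦normalise⟧ α (i , x))) i↦j) (trans (sym (act≡⟦normalise⟧ α (j , y))) j↦i)
    from : CompatibleMotion i j x y → Swappable (i , x) (j , y)
    from (e , c , i↦j , j↦i , compatible) with compatible⇒swap e c i↦j j↦i compatible
    ... | S , i↦j′ , j↦i′ =
      realise (nf e c S) , trans (act-realise (nf e c S) (i , x)) i↦j′ , trans (act-realise (nf e c S) (j , y)) j↦i′

  Conditions : Fin N → Fin N → Vec Bool k → Vec Bool k → Set
  Conditions i j x y =
    j ≡ i ⊎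
    (j ≢ i × Compatible (orient true) i j x y) ⊎
    (Σ ℕ λ h → N ≡ h + h × j ≡ addMod i h × Compatible (orient false) i j x y)

  compatibleMotion⇒conditions : ∀ i j x y → CompatibleMotion i j x y → Conditions i j x y
  compatibleMotion⇒conditions i j x y (true , _ , _ , _ , compatible) with j Fin.≟ i
  ... | yes j≡i = inj₁ j≡i
  ... | no j≢i  = inj₂ (inj₁ (j≢i , compatible))
  compatibleMotion⇒conditions i j x y (false , c , i↦j , j↦i , compatible) with addMod-swap c i↦j j↦i
  ... | inj₁ j≡i                = inj₁ j≡i
  ... | inj₂ (h , N≡2h , j≡i+h) = inj₂ (inj₂ (h , N≡2h , j≡i+h , compatible))

  conditions⇒compatibleMotion : ∀ i j x y → Conditions i j x y → CompatibleMotion i j x y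
  conditions⇒compatibleMotion i .i x y (inj₁ refl) =
    false , 0 , addMod-identityʳ i , addMod-identityʳ i , λ m p q → mk⇔ sym sym
  conditions⇒compatibleMotion i j x y (inj₂ (inj₁ (_ , compatible))) =
    true , toℕ i + toℕ j , reflect-swap i j ,
    trans (cong (λ s → [ (N ∸ toℕ j) + s ]) (+-comm (toℕ i) (toℕ j))) (reflect-swap j i) , compatible
  conditions⇒compatibleMotion i j x y (inj₂ (inj₂ (h , N≡2h , j≡i+h , compatible))) =
    false , h , sym j≡i+h , trans (cong (λ j → addMod j h) j≡i+h) (addMod-half-turn N≡2h i) , compatible

lemma5p2 : (n k : ℕ) → 3 ≤ n → 1 ≤ k → k < n →
    (i j : Fin n) (x y : Vec Bool k) →
    (Σ (List (Gen n)) λ α → (act α (i , x) ≡ (j , y)) × (act α (j , y) ≡ (i , x)))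
    ⇔
    ((j ≡ i)
     ⊎ ((j ≢ i) × ((m : Fin n) (p : diffℕ m i < k) (q : diffℕ m j < k) →
          (lookup (reverse x) (fromℕ< q) ≡ lookup y (fromℕ< q))
          ⇔ (lookup (reverse y) (fromℕ< p) ≡ lookup x (fromℕ< p))))
     ⊎ (Σ ℕ λ h → (n ≡ h + h) × (j ≡ addMod i h) ×
          ((m : Fin n) (p : diffℕ m i < k) (q : diffℕ m j < k) →
            (lookup x (fromℕ< q) ≡ lookup y (fromℕ< q))
            ⇔ (lookup y (fromℕ< p) ≡ lookup x (fromℕ< p)))))
lemma5p2 zero     _        () _  _   _ _ _ _
lemma5p2 (suc n′) zero     _  () _   _ _ _ _
lemma5p2 (suc n′) (suc k′) _  _  k<n i j x y =
  mk⇔ (compatibleMotion⇒conditions i j x y) (conditions⇒compatibleMotion i j x y)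
    ⇔-∘ swappable⇔compatibleMotion i j x y
  where open Action n′ k′ (<⇒≤ k<n)
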